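{- Let $n,d$ be positive integers. For $1\le i\le m$ let $(A_i^{(1)},\ldots,A_i^{(d)})$ be a $d$-tuple of pairwise disjoint subsets of $[n]=\{1,\ldots,n\}$. Suppose that for all $1\le i<j\le m$ there exist $1\le p<q\le d$ with $A_i^{(p)}\cap A_j^{(q)}\neq\emptyset$. Then $$\sum_{i=1}^m \frac{1}{\binom{|A_i^{(1)}|+\cdots+|A_i^{(d)}|}{|A_i^{(1)}|,\ldots,|A_i^{(d)}|}}\le \binom{n+d-1}{d-1},$$ where $\binom{a_1+\cdots+a_d}{a_1,\ldots,a_d}=\frac{(a_1+\cdots+a_d)!}{a_1!\cdots a_d!}$ denotes the multinomial coefficient.
   Context: A $d$-tuple of pairwise disjoint subsets of $[n]$ is called a $d$-partition; a collection of $d$-partitions satisfying the stated condition for all $i<j$ is called a skew Bollobás system of $d$-partitions. -}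

module Defs where

open import Data.Nat using (ℕ; zero; suc; _+_; _*_; _!)
open import Data.Nat.Properties using (_!≢0)
open import Data.Fin using (Fin; zero; suc)
open import Data.Fin.Subset using (Subset; ∣_∣)
open import Data.Integer using (+_)
open import Data.Rational using (ℚ; 0ℚ; _/_) renaming (_+_ to _+ℚ_)

sumℕ : ∀ {k} → (Fin k → ℕ) → ℕ
sumℕ {zero} f = 0
sumℕ {suc k} f = f zero + sumℕ (λ i → f (suc i))

prodℕ : ∀ {k} → (Fin k → ℕ) → ℕ
prodℕ {zero} f = 1
prodℕ {suc k} f = f zero * prodℕ (λ i → f (suc i))

sumℚ : ∀ {k} → (Fin k → ℚ) → ℚ
sumℚ {zero} f = 0ℚ
sumℚ {suc k} f = f zero +ℚ sumℚ (λ i → f (suc i))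

invMultinomial : ∀ {d} → (Fin d → ℕ) → ℚ
invMultinomial a = (+ prodℕ (λ k → a k !)) / (sumℕ a !)
  where instance _ = sumℕ a !≢0

-- Distribute [n] into d linearly ordered lists, and call such a distribution compatible with a
-- d-partition A if every element of A⁽ᵖ⁾ lands in list p.  If the parts of A have sizes a_p with
-- sum s, there are Π a_p! · (n+d−1)! / (s+d−1)! compatible distributions: order each part, then
-- insert the n − s remaining elements one at a time into one of the gaps.  In particular there are
-- n! · C(n+d−1, d−1) distributions in all.  When A_i⁽ᵖ⁾ ∩ A_j⁽q⁾ ≠ ∅ for some p ≠ q, no distribution
-- is compatible with both A_i and A_j, so the counts of the A_i sum to at most n! · C(n+d−1, d−1).
-- Since (s+d−1)!/s! ≤ (n+d−1)!/n! for s ≤ n, the count of A_i is at least n! divided by the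
-- multinomial coefficient of A_i, and the theorem follows.

module Submission where

open import Defs

module Arrangements where

  open import Data.Bool using (Bool; true; false; T; if_then_else_; _∧_)
  open import Data.Empty using (⊥; ⊥-elim)
  open import Data.Fin using (Fin; zero; suc; _<_; _≟_)
  open import Data.Fin.Properties using (any?; all?)
  open import Data.Fin.Subset using (Subset; _∩_; _∈_; _∉_; Empty; Nonempty; ∣_∣) renaming (⊥ to ⊥ˢ)
  open import Data.Fin.Subset.Properties using (_∈?_; ∉⊥; ∣p∣≤n; ∣⊥∣≡0; x∈p∩q⁺; x∈p∩q⁻; drop-there)
  open import Data.Nat using (ℕ; zero; suc; _+_; _*_; _∸_; _≤_; _!; z≤n; s≤s)
  open import Data.Nat.Combinatorics using (_C_; k![n∸k]!∣n!)
  open import Data.Nat.Combinatorics.Specification using (nCk≡n!/k![n-k]!)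
  open import Data.Nat.DivMod using (_/_; m/n*n≡m)
  open import Data.Nat.Properties hiding (_≟_)
  open import Data.Product using (Σ; _×_; _,_; proj₁)
  open import Data.Sum using (inj₁; inj₂)
  open import Data.Vec using (_∷_; tail; here; there)
  open import Data.Vec.Functional using (updateAt)
  open import Data.Vec.Functional.Properties using (updateAt-updates; updateAt-minimal)
  open import Function using (_∘_; _⇔_; mk⇔)
  open import Relation.Binary.PropositionalEquality
  open import Relation.Nullary using (Dec; yes; no; does; _→-dec_)
  open import Relation.Nullary.Decidable using (dec-true; does-⇔)
  open import Algebra.Properties.CommutativeSemigroup *-commutativeSemigroup
    using (x∙yz≈y∙xz; x∙yz≈xz∙y; xy∙z≈xz∙y)
  open import Algebra.Properties.Semiring.Sum +-*-semiring
    using (sum; sum-cong-≗; sum-replicate-zero; ∑-distrib-+; ∑-comm; *-distribʳ-sum)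

  private
    variable
      d k m n : ℕ

  sumℕ≡sum : (f : Fin k → ℕ) → sumℕ f ≡ sum f
  sumℕ≡sum {zero}  f = refl
  sumℕ≡sum {suc k} f = cong (f zero +_) (sumℕ≡sum (λ i → f (suc i)))

  sum-≡0 : (f : Fin k → ℕ) → (∀ i → f i ≡ 0) → sum f ≡ 0
  sum-≡0 {k} f f≡0 = trans (sum-cong-≗ f≡0) (sum-replicate-zero k)

  sum-mono-≤ : (f g : Fin k → ℕ) → (∀ i → f i ≤ g i) → sum f ≤ sum g
  sum-mono-≤ {zero}  f g f≤g = z≤n
  sum-mono-≤ {suc k} f g f≤g = +-mono-≤ (f≤g zero) (sum-mono-≤ _ _ (λ i → f≤g (suc i)))

  sum-suc : (f : Fin k → ℕ) → sum (λ i → suc (f i)) ≡ sum f + k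
  sum-suc {zero}  f = refl
  sum-suc {suc k} f = begin
    suc (f zero + sum (λ i → suc (f (suc i)))) ≡⟨ cong (λ s → suc (f zero + s)) (sum-suc (λ i → f (suc i))) ⟩
    suc (f zero + (sum (λ i → f (suc i)) + k)) ≡⟨ cong suc (+-assoc (f zero) _ k) ⟨
    suc (f zero + sum (λ i → f (suc i)) + k)   ≡⟨ +-suc _ k ⟨
    f zero + sum (λ i → f (suc i)) + suc k     ∎
    where open ≡-Reasoning

  sum-updateAt-suc : (c : Fin k → ℕ) (p : Fin k) → sum (updateAt c p suc) ≡ suc (sum c)
  sum-updateAt-suc c zero    = refl
  sum-updateAt-suc c (suc p) =
    trans (cong (c zero +_) (sum-updateAt-suc (λ i → c (suc i)) p)) (+-suc (c zero) _)

  sum-*-scale : (f g : Fin k → ℕ) (x y : ℕ) → (∀ i → f i * x ≡ g i * y) → sum f * x ≡ sum g * y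
  sum-*-scale f g x y eq = begin
    sum f * x             ≡⟨ *-distribʳ-sum x f ⟩
    sum (λ i → f i * x)   ≡⟨ sum-cong-≗ eq ⟩
    sum (λ i → g i * y)   ≡⟨ *-distribʳ-sum y g ⟨
    sum g * y             ∎
    where open ≡-Reasoning

  sum-*-!-cancel : (f w : Fin k → ℕ) (M y : ℕ) → sum w ≡ suc M → (∀ i → f i * suc M ! ≡ w i * y) →
    sum f * M ! ≡ y
  sum-*-!-cancel f w M y ∑w≡1+M eq = *-cancelˡ-≡ (sum f * M !) y (suc M) (begin
    suc M * (sum f * M !)   ≡⟨ x∙yz≈y∙xz (suc M) (sum f) (M !) ⟩
    sum f * suc M !         ≡⟨ sum-*-scale f w (suc M !) y eq ⟩
    sum w * y               ≡⟨ cong (_* y) ∑w≡1+M ⟩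
    suc M * y               ∎)
    where open ≡-Reasoning

  sum-if-≟ : (f : Fin k → ℕ) (q : Fin k) → sum (λ p → if does (p ≟ q) then f p else 0) ≡ f q
  sum-if-≟ {suc k} f zero = trans (cong (f zero +_) (sum-≡0 {k} _ (λ _ → refl))) (+-identityʳ (f zero))
  sum-if-≟ f (suc q)      = sum-if-≟ (λ i → f (suc i)) q

  sum-if-∧ : ∀ b (b′ : Fin k → Bool) (f : Fin k → ℕ) →
    (if b then sum (λ p → if b′ p then f p else 0) else 0) ≡ sum (λ p → if b ∧ b′ p then f p else 0)
  sum-if-∧     true  b′ f = refl
  sum-if-∧ {k} false b′ f = sym (sum-≡0 {k} _ (λ _ → refl))

  sum-if-≤ : (sel : Fin m → Bool) (x : ℕ) → (∀ i j → i < j → T (sel i) → T (sel j) → ⊥) →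
    sum (λ i → if sel i then x else 0) ≤ x
  sum-if-≤ {zero}  sel x _ = z≤n
  sum-if-≤ {suc m} sel x unique with sel zero | unique zero
  ... | true  | unique₀ = ≤-reflexive (trans (cong (x +_) (sum-≡0 _ rest)) (+-identityʳ x))
    where
    rest : ∀ i → (if sel (suc i) then x else 0) ≡ 0
    rest i with sel (suc i) | unique₀ (suc i) (s≤s z≤n) _
    ... | true  | sel₀∧selᵢ⇒⊥ = ⊥-elim (sel₀∧selᵢ⇒⊥ _)
    ... | false | _           = refl
  ... | false | _ = sum-if-≤ (λ i → sel (suc i)) x (λ i j i<j → unique (suc i) (suc j) (s≤s i<j))

  T-∧-does : ∀ {a} {P : Set a} b (P? : Dec P) → T (b ∧ does P?) → T b × P
  T-∧-does true (yes p) _ = _ , p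

  prodℕ-cong : (f g : Fin k → ℕ) → (∀ i → f i ≡ g i) → prodℕ f ≡ prodℕ g
  prodℕ-cong {zero}  f g f≡g = refl
  prodℕ-cong {suc k} f g f≡g = cong₂ _*_ (f≡g zero) (prodℕ-cong _ _ (λ i → f≡g (suc i)))

  prodℕ-ones : ∀ k → prodℕ {k} (λ _ → 1) ≡ 1
  prodℕ-ones zero    = refl
  prodℕ-ones (suc k) = trans (+-identityʳ _) (prodℕ-ones k)

  prodℕ-updateAt-suc-! : (c x : Fin k → ℕ) (p : Fin k) →
    prodℕ (λ r → (updateAt c p suc r + x r) !) ≡ suc (c p + x p) * prodℕ (λ r → (c r + x r) !)
  prodℕ-updateAt-suc-! c x zero    = *-assoc (suc (c zero + x zero)) ((c zero + x zero) !) _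
  prodℕ-updateAt-suc-! c x (suc p) = trans
    (cong ((c zero + x zero) ! *_) (prodℕ-updateAt-suc-! (λ i → c (suc i)) (λ i → x (suc i)) p))
    (x∙yz≈y∙xz ((c zero + x zero) !) (suc (c (suc p) + x (suc p))) _)

  updateAt-suc-+ : (c x : Fin k → ℕ) (p r : Fin k) → updateAt c p suc r + x r ≡ c r + updateAt x p suc r
  updateAt-suc-+ c x p r with r ≟ p
  ... | yes refl = begin
    updateAt c r suc r + x r   ≡⟨ cong (_+ x r) (updateAt-updates r c) ⟩
    suc (c r + x r)            ≡⟨ +-suc (c r) (x r) ⟨
    c r + suc (x r)            ≡⟨ cong (c r +_) (updateAt-updates r x) ⟨
    c r + updateAt x r suc r   ∎
    where open ≡-Reasoning
  ... | no r≢p = cong₂ _+_ (updateAt-minimal r p c r≢p) (sym (updateAt-minimal r p x r≢p))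

  [n+k]!/n!-mono-≤ : ∀ k {s n} → s ≤ n → n ! * (s + k) ! ≤ (n + k) ! * s !
  [n+k]!/n!-mono-≤ k {s} {zero} z≤n = ≤-reflexive (*-comm 1 (k !))
  [n+k]!/n!-mono-≤ k {s} {suc n} s≤1+n with m≤n⇒m<n∨m≡n s≤1+n
  ... | inj₂ refl      = ≤-reflexive (*-comm (suc n !) _)
  ... | inj₁ (s≤s s≤n) = begin
    suc n ! * (s + k) !               ≡⟨ *-assoc (suc n) (n !) _ ⟩
    suc n * (n ! * (s + k) !)         ≤⟨ *-mono-≤ (s≤s (m≤m+n n k)) ([n+k]!/n!-mono-≤ k s≤n) ⟩
    suc (n + k) * ((n + k) ! * s !)   ≡⟨ *-assoc (suc (n + k)) ((n + k) !) (s !) ⟨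
    (suc n + k) ! * s !               ∎
    where open ≤-Reasoning

  [n+k]Ck*k!*n!≡[n+k]! : ∀ n k → ((n + k) C k) * (k ! * n !) ≡ (n + k) !
  [n+k]Ck*k!*n!≡[n+k]! n k = begin
    ((n + k) C k) * (k ! * n !)          ≡⟨ cong (λ m → ((n + k) C k) * (k ! * m !)) (m+n∸n≡m n k) ⟨
    ((n + k) C k) * D                    ≡⟨ cong (_* D) (nCk≡n!/k![n-k]! k≤n+k) ⟩
    (n + k) ! / D * D                    ≡⟨ m/n*n≡m (k![n∸k]!∣n! k≤n+k) ⟩
    (n + k) !                            ∎
    where
    open ≡-Reasoning
    D = k ! * (n + k ∸ k) !
    instance _ = k !* (n + k ∸ k) !≢0
    k≤n+k = m≤n+m k n

  Partition : ℕ → ℕ → Set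
  Partition d n = Fin d → Subset n

  Disjoint : Partition d n → Set
  Disjoint A = ∀ p q → p ≢ q → Empty (A p ∩ A q)

  -- The skew condition of the theorem is used only through this weaker, symmetric one.
  Conflicting : Partition d n → Partition d n → Set
  Conflicting {d} A B = Σ (Fin d) λ p → Σ (Fin d) λ q → p ≢ q × Nonempty (A p ∩ B q)

  ∅ : Partition d n
  ∅ _ = ⊥ˢ

  tails : Partition d (suc n) → Partition d n
  tails A p = tail (A p)

  size : Partition d n → ℕ
  size A = sum (λ p → ∣ A p ∣)

  disjoint-∅ : Disjoint (∅ {d} {n})
  disjoint-∅ _ _ _ (_ , x∈) = ∉⊥ (proj₁ (x∈p∩q⁻ ⊥ˢ ⊥ˢ x∈))

  ∈-tail⁺ : ∀ {x} {v : Subset (suc n)} → x ∈ tail v → suc x ∈ v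
  ∈-tail⁺ {v = _ ∷ _} = there

  ∈-tail⁻ : ∀ {x} {v : Subset (suc n)} → suc x ∈ v → x ∈ tail v
  ∈-tail⁻ {v = _ ∷ _} = drop-there

  zero∈⇒∣∣≡1+∣tail∣ : (v : Subset (suc n)) → zero ∈ v → ∣ v ∣ ≡ suc ∣ tail v ∣
  zero∈⇒∣∣≡1+∣tail∣ (true ∷ v) _ = refl

  zero∉⇒∣∣≡∣tail∣ : (v : Subset (suc n)) → zero ∉ v → ∣ v ∣ ≡ ∣ tail v ∣
  zero∉⇒∣∣≡∣tail∣ (true ∷ v)  zero∉v = ⊥-elim (zero∉v here)
  zero∉⇒∣∣≡∣tail∣ (false ∷ v) _      = refl

  disjoint-tails : (A : Partition d (suc n)) → Disjoint A → Disjoint (tails A)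
  disjoint-tails A disj p q p≢q (x , x∈)
    with x∈Ap , x∈Aq ← x∈p∩q⁻ (tails A p) (tails A q) x∈
    = disj p q p≢q (suc x , x∈p∩q⁺ (∈-tail⁺ x∈Ap , ∈-tail⁺ x∈Aq))

  Fits : Fin d → Partition d (suc n) → Set
  Fits p A = ∀ r → zero ∈ A r → r ≡ p

  fits? : (p : Fin d) (A : Partition d (suc n)) → Dec (Fits p A)
  fits? p A = all? (λ r → zero ∈? A r →-dec r ≟ p)

  conflicting-tails : ∀ p (A B : Partition d (suc n)) → Fits p A → Fits p B →
    Conflicting A B → Conflicting (tails A) (tails B)
  conflicting-tails p A B fitsA fitsB (r , s , r≢s , zero , zero∈)
    with zero∈Ar , zero∈Bs ← x∈p∩q⁻ (A r) (B s) zero∈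
    = ⊥-elim (r≢s (trans (fitsA r zero∈Ar) (sym (fitsB s zero∈Bs))))
  conflicting-tails p A B fitsA fitsB (r , s , r≢s , suc x , x∈)
    with x∈Ar , x∈Bs ← x∈p∩q⁻ (A r) (B s) x∈
    = r , s , r≢s , x , x∈p∩q⁺ (∈-tail⁻ x∈Ar , ∈-tail⁻ x∈Bs)

  data FirstElement (A : Partition d (suc n)) : Set where
    uncoloured : (∀ r → zero ∉ A r) → FirstElement A
    coloured   : ∀ q → zero ∈ A q → Fits q A → FirstElement A

  firstElement : (A : Partition d (suc n)) → Disjoint A → FirstElement A
  firstElement A disj with any? (λ r → zero ∈? A r)
  ... | no ∄r             = uncoloured (λ r zero∈Ar → ∄r (r , zero∈Ar))
  ... | yes (q , zero∈Aq) = coloured q zero∈Aq fits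
    where
    fits : Fits q A
    fits r zero∈Ar with r ≟ q
    ... | yes r≡q = r≡q
    ... | no r≢q  = ⊥-elim (disj r q r≢q (zero , x∈p∩q⁺ (zero∈Ar , zero∈Aq)))

  size-uncoloured : (A : Partition d (suc n)) → (∀ r → zero ∉ A r) → size A ≡ size (tails A)
  size-uncoloured A zero∉A = sum-cong-≗ (λ p → zero∉⇒∣∣≡∣tail∣ (A p) (zero∉A p))

  ∣∣-coloured : (A : Partition d (suc n)) (q : Fin d) → zero ∈ A q → Fits q A →
    ∀ p → ∣ A p ∣ ≡ updateAt (λ r → ∣ tails A r ∣) q suc p
  ∣∣-coloured A q zero∈Aq fits p with p ≟ q
  ... | yes refl = trans (zero∈⇒∣∣≡1+∣tail∣ (A p) zero∈Aq) (sym (updateAt-updates p _))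
  ... | no p≢q   = trans (zero∉⇒∣∣≡∣tail∣ (A p) (λ zero∈Ap → p≢q (fits p zero∈Ap)))
                         (sym (updateAt-minimal p q _ p≢q))

  size-coloured : (A : Partition d (suc n)) (q : Fin d) → zero ∈ A q → Fits q A →
    size A ≡ suc (size (tails A))
  size-coloured A q zero∈Aq fits = trans (sum-cong-≗ (∣∣-coloured A q zero∈Aq fits)) (sum-updateAt-suc _ q)

  size≤n : (A : Partition d n) → Disjoint A → size A ≤ n
  size≤n {n = zero}  A _ = ≤-reflexive (sum-≡0 _ (λ p → n≤0⇒n≡0 (∣p∣≤n (A p))))
  size≤n {n = suc n} A disj with firstElement A disj
  ... | uncoloured zero∉A =
    ≤-trans (≤-reflexive (size-uncoloured A zero∉A)) (m≤n⇒m≤1+n (size≤n (tails A) (disjoint-tails A disj)))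
  ... | coloured q zero∈Aq fits =
    ≤-trans (≤-reflexive (size-coloured A q zero∈Aq fits)) (s≤s (size≤n (tails A) (disjoint-tails A disj)))

  -- Counts the distributions of [n] into d ordered lists compatible with A when list p already
  -- holds c p further labelled items: the first element goes into any list it fits, and once all
  -- elements are placed, the lists can be ordered in Π (c p)! ways.
  arrangements : (Fin d → ℕ) → Partition d n → ℕ
  arrangements {n = zero}  c A = prodℕ (λ p → c p !)
  arrangements {n = suc n} c A =
    sum (λ p → if does (fits? p A) then arrangements (updateAt c p suc) (tails A) else 0)

  arrangements-uncoloured : (A : Partition d (suc n)) (c : Fin d → ℕ) → (∀ r → zero ∉ A r) →
    arrangements c A ≡ sum (λ p → arrangements (updateAt c p suc) (tails A))
  arrangements-uncoloured A c zero∉A = sum-cong-≗ λ p →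
    cong (λ b → if b then arrangements (updateAt c p suc) (tails A) else 0)
         (dec-true (fits? p A) (λ r zero∈Ar → ⊥-elim (zero∉A r zero∈Ar)))

  arrangements-coloured : (A : Partition d (suc n)) (q : Fin d) → zero ∈ A q → Fits q A →
    (c : Fin d → ℕ) → arrangements c A ≡ arrangements (updateAt c q suc) (tails A)
  arrangements-coloured A q zero∈Aq fits c = trans
    (sum-cong-≗ λ p → cong (λ b → if b then arrangements (updateAt c p suc) (tails A) else 0)
                           (does-⇔ (fits⇔≡ p) (fits? p A) (p ≟ q)))
    (sum-if-≟ (λ p → arrangements (updateAt c p suc) (tails A)) q)
    where
    fits⇔≡ : ∀ p → Fits p A ⇔ p ≡ q
    fits⇔≡ p = mk⇔ (λ fitsₚ → sym (fitsₚ q zero∈Aq)) (λ { refl → fits })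

  PairwiseConflicting : (Fin m → Bool) → (Fin m → Partition d n) → Set
  PairwiseConflicting sel A = ∀ i j → i < j → T (sel i) → T (sel j) → Conflicting (A i) (A j)

  -- The mask sel is needed for the induction: the family splits by the list taking the first element.
  sum-arrangements≤arrangements-∅ : (c : Fin d → ℕ) (sel : Fin m → Bool) (A : Fin m → Partition d n) →
    PairwiseConflicting sel A →
    sum (λ i → if sel i then arrangements c (A i) else 0) ≤ arrangements c (∅ {n = n})
  sum-arrangements≤arrangements-∅ {n = zero} c sel A conflicting =
    sum-if-≤ sel _ (λ i j i<j selᵢ selⱼ → no-conflict (conflicting i j i<j selᵢ selⱼ))
    where
    no-conflict : ∀ {i j} → Conflicting (A i) (A j) → ⊥
    no-conflict (_ , _ , _ , () , _)
  sum-arrangements≤arrangements-∅ {d} {m} {suc n} c sel A conflicting = begin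
    sum (λ i → if sel i then arrangements c (A i) else 0)
      ≡⟨ sum-cong-≗ (λ i → sum-if-∧ (sel i) (λ p → does (fits? p (A i))) (branch i)) ⟩
    sum (λ i → sum (λ p → if sel′ p i then branch i p else 0))
      ≡⟨ ∑-comm (λ i p → if sel′ p i then branch i p else 0) ⟩
    sum (λ p → sum (λ i → if sel′ p i then branch i p else 0))
      ≤⟨ sum-mono-≤ _ _ (λ p → sum-arrangements≤arrangements-∅ (c⁺ p) (sel′ p) (tails ∘ A) (conflicting′ p)) ⟩
    sum (λ p → arrangements (c⁺ p) (∅ {n = n}))
      ≡⟨ arrangements-uncoloured ∅ c (λ _ → ∉⊥) ⟨
    arrangements c (∅ {n = suc n}) ∎
    where
    open ≤-Reasoning
    c⁺ : Fin d → Fin d → ℕ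
    c⁺ p = updateAt c p suc
    branch : Fin m → Fin d → ℕ
    branch i p = arrangements (c⁺ p) (tails (A i))
    sel′ : Fin d → Fin m → Bool
    sel′ p i = sel i ∧ does (fits? p (A i))
    conflicting′ : ∀ p → PairwiseConflicting (sel′ p) (tails ∘ A)
    conflicting′ p i j i<j tᵢ tⱼ
      with selᵢ , fitsᵢ ← T-∧-does (sel i) (fits? p (A i)) tᵢ
         | selⱼ , fitsⱼ ← T-∧-does (sel j) (fits? p (A j)) tⱼ
      = conflicting-tails p (A i) (A j) fitsᵢ fitsⱼ (conflicting i j i<j selᵢ selⱼ)

  ClosedForm : (Fin (suc d) → ℕ) → Partition (suc d) n → Set
  ClosedForm {d} {n} c A =
    arrangements c A * (sum c + size A + d) ! ≡ prodℕ (λ p → (c p + ∣ A p ∣) !) * (sum c + n + d) !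

  closed-form-uncoloured : (c : Fin (suc d) → ℕ) (A : Partition (suc d) (suc n)) → (∀ r → zero ∉ A r) →
    (∀ p → ClosedForm (updateAt c p suc) (tails A)) → ClosedForm c A
  closed-form-uncoloured {d} {n} c A zero∉A ih = begin
    arrangements c A * (sum c + size A + d) !
      ≡⟨ cong₂ (λ a s → a * (sum c + s + d) !)
               (arrangements-uncoloured A c zero∉A) (size-uncoloured A zero∉A) ⟩
    sum (λ p → arrangements (c⁺ p) tA) * M !
      ≡⟨ sum-*-!-cancel (λ p → arrangements (c⁺ p) tA) (λ p → suc (c p + ∣ tA p ∣)) M (P * K) ∑w≡1+M step ⟩
    P * K
      ≡⟨ cong₂ _*_
           (prodℕ-cong _ _ λ p → cong (λ a → (c p + a) !) (sym (zero∉⇒∣∣≡∣tail∣ (A p) (zero∉A p))))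
           (cong (λ s → (s + d) !) (sym (+-suc (sum c) n))) ⟩
    prodℕ (λ p → (c p + ∣ A p ∣) !) * (sum c + suc n + d) ! ∎
    where
    open ≡-Reasoning
    tA = tails A
    c⁺ : Fin (suc d) → Fin (suc d) → ℕ
    c⁺ p = updateAt c p suc
    M = sum c + size tA + d
    P = prodℕ (λ p → (c p + ∣ tA p ∣) !)
    K = (suc (sum c) + n + d) !
    ∑w≡1+M : sum (λ p → suc (c p + ∣ tA p ∣)) ≡ suc M
    ∑w≡1+M = begin
      sum (λ p → suc (c p + ∣ tA p ∣))    ≡⟨ sum-suc (λ p → c p + ∣ tA p ∣) ⟩
      sum (λ p → c p + ∣ tA p ∣) + suc d  ≡⟨ cong (_+ suc d) (∑-distrib-+ c (λ p → ∣ tA p ∣)) ⟩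
      sum c + size tA + suc d             ≡⟨ +-suc (sum c + size tA) d ⟩
      suc M                               ∎
    step : ∀ p → arrangements (c⁺ p) tA * suc M ! ≡ suc (c p + ∣ tA p ∣) * (P * K)
    step p = begin
      arrangements (c⁺ p) tA * suc M !
        ≡⟨ cong (λ s → arrangements (c⁺ p) tA * (s + size tA + d) !) (sum-updateAt-suc c p) ⟨
      arrangements (c⁺ p) tA * (sum (c⁺ p) + size tA + d) !
        ≡⟨ ih p ⟩
      prodℕ (λ r → (c⁺ p r + ∣ tA r ∣) !) * (sum (c⁺ p) + n + d) !
        ≡⟨ cong₂ _*_ (prodℕ-updateAt-suc-! c (λ r → ∣ tA r ∣) p)
                     (cong (λ s → (s + n + d) !) (sum-updateAt-suc c p)) ⟩
      suc (c p + ∣ tA p ∣) * P * K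
        ≡⟨ *-assoc (suc (c p + ∣ tA p ∣)) P K ⟩
      suc (c p + ∣ tA p ∣) * (P * K) ∎

  closed-form-coloured : (c : Fin (suc d) → ℕ) (A : Partition (suc d) (suc n)) (q : Fin (suc d)) →
    zero ∈ A q → Fits q A → ClosedForm (updateAt c q suc) (tails A) → ClosedForm c A
  closed-form-coloured {d} {n} c A q zero∈Aq fits ih = begin
    arrangements c A * (sum c + size A + d) !
      ≡⟨ cong₂ (λ a s → a * (sum c + s + d) !)
               (arrangements-coloured A q zero∈Aq fits c) (size-coloured A q zero∈Aq fits) ⟩
    arrangements c⁺ tA * (sum c + suc (size tA) + d) !
      ≡⟨ cong (λ s → arrangements c⁺ tA * (s + d) !)
              (trans (+-suc (sum c) (size tA)) (cong (_+ size tA) (sym (sum-updateAt-suc c q)))) ⟩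
    arrangements c⁺ tA * (sum c⁺ + size tA + d) !
      ≡⟨ ih ⟩
    prodℕ (λ r → (c⁺ r + ∣ tA r ∣) !) * (sum c⁺ + n + d) !
      ≡⟨ cong₂ _*_ (prodℕ-cong _ _ λ r → cong _! (trans (updateAt-suc-+ c _ q r)
                                                       (cong (c r +_) (sym (∣∣-coloured A q zero∈Aq fits r)))))
                   (cong (λ s → (s + d) !) (trans (cong (_+ n) (sum-updateAt-suc c q)) (sym (+-suc (sum c) n)))) ⟩
    prodℕ (λ r → (c r + ∣ A r ∣) !) * (sum c + suc n + d) ! ∎
    where
    open ≡-Reasoning
    tA = tails A
    c⁺ = updateAt c q suc

  closed-form : (c : Fin (suc d) → ℕ) (A : Partition (suc d) n) → Disjoint A → ClosedForm c A
  closed-form {d} {zero} c A disj = cong₂ _*_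
    (prodℕ-cong _ _ λ p → cong _! (sym (trans (cong (c p +_) (n≤0⇒n≡0 (∣p∣≤n (A p)))) (+-identityʳ (c p)))))
    (cong (λ s → (sum c + s + d) !) (n≤0⇒n≡0 (size≤n A disj)))
  closed-form {n = suc n} c A disj with firstElement A disj
  ... | uncoloured zero∉A =
    closed-form-uncoloured c A zero∉A (λ p → closed-form (updateAt c p suc) (tails A) (disjoint-tails A disj))
  ... | coloured q zero∈Aq fits =
    closed-form-coloured c A q zero∈Aq fits (closed-form (updateAt c q suc) (tails A) (disjoint-tails A disj))

  zeros : Fin k → ℕ
  zeros _ = 0

  closed-form₀ : (A : Partition (suc d) n) → Disjoint A →
    arrangements zeros A * (size A + d) ! ≡ prodℕ (λ p → ∣ A p ∣ !) * (n + d) !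
  closed-form₀ {d} {n} A disj =
    subst (λ z → arrangements zeros A * (z + size A + d) ! ≡ prodℕ (λ p → ∣ A p ∣ !) * (z + n + d) !)
          (sum-≡0 {suc d} zeros (λ _ → refl)) (closed-form zeros A disj)

  arrangements-∅ : ∀ n → arrangements zeros (∅ {suc d} {n}) ≡ ((n + d) C d) * n !
  arrangements-∅ {d} n = *-cancelʳ-≡ _ _ (d !) {{d !≢0}} (begin
    arrangements zeros E * d !              ≡⟨ cong (λ s → arrangements zeros E * (s + d) !) size-E≡0 ⟨
    arrangements zeros E * (size E + d) !   ≡⟨ closed-form₀ E disjoint-∅ ⟩
    prodℕ (λ p → ∣ E p ∣ !) * (n + d) !     ≡⟨ cong (_* (n + d) !) (prodℕ-cong {suc d} _ _ (λ _ → cong _! (∣⊥∣≡0 n))) ⟩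
    prodℕ {suc d} (λ _ → 1) * (n + d) !     ≡⟨ cong (_* (n + d) !) (prodℕ-ones (suc d)) ⟩
    1 * (n + d) !                           ≡⟨ *-identityˡ _ ⟩
    (n + d) !                               ≡⟨ [n+k]Ck*k!*n!≡[n+k]! n d ⟨
    ((n + d) C d) * (d ! * n !)             ≡⟨ x∙yz≈xz∙y ((n + d) C d) (d !) (n !) ⟩
    ((n + d) C d) * n ! * d !               ∎)
    where
    open ≡-Reasoning
    E = ∅ {suc d} {n}
    size-E≡0 : size E ≡ 0
    size-E≡0 = sum-≡0 {suc d} _ (λ _ → ∣⊥∣≡0 n)

  sumℕ-arrangements≤[n+d]Cd*n! : (A : Fin m → Partition (suc d) n) →
    (∀ i j → i < j → Conflicting (A i) (A j)) → sumℕ (λ i → arrangements zeros (A i)) ≤ ((n + d) C d) * n !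
  sumℕ-arrangements≤[n+d]Cd*n! {d = d} {n} A conflicting = begin
    sumℕ (λ i → arrangements zeros (A i))
      ≡⟨ sumℕ≡sum (λ i → arrangements zeros (A i)) ⟩
    sum (λ i → arrangements zeros (A i))
      ≤⟨ sum-arrangements≤arrangements-∅ zeros (λ _ → true) A (λ i j i<j _ _ → conflicting i j i<j) ⟩
    arrangements zeros (∅ {n = n})
      ≡⟨ arrangements-∅ n ⟩
    ((n + d) C d) * n ! ∎
    where open ≤-Reasoning

  prodℕ-!*n!≤arrangements*sumℕ! : (A : Partition (suc d) n) → Disjoint A →
    prodℕ (λ p → ∣ A p ∣ !) * n ! ≤ arrangements zeros A * sumℕ (λ p → ∣ A p ∣) !
  prodℕ-!*n!≤arrangements*sumℕ! {d} {n} A disj = *-cancelʳ-≤ _ _ ((s + d) !) {{(s + d) !≢0}} (begin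
    Π * n ! * (s + d) !
      ≡⟨ *-assoc Π (n !) _ ⟩
    Π * (n ! * (s + d) !)
      ≤⟨ *-monoʳ-≤ Π ([n+k]!/n!-mono-≤ d (size≤n A disj)) ⟩
    Π * ((n + d) ! * s !)
      ≡⟨ *-assoc Π _ _ ⟨
    Π * (n + d) ! * s !
      ≡⟨ cong (_* s !) (closed-form₀ A disj) ⟨
    arrangements zeros A * (s + d) ! * s !
      ≡⟨ xy∙z≈xz∙y (arrangements zeros A) _ _ ⟩
    arrangements zeros A * s ! * (s + d) !
      ≡⟨ cong (λ t → arrangements zeros A * t ! * (s + d) !) (sumℕ≡sum (λ p → ∣ A p ∣)) ⟨
    arrangements zeros A * sumℕ (λ p → ∣ A p ∣) ! * (s + d) ! ∎)
    where
    open ≤-Reasoning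
    s = size A
    Π = prodℕ (λ p → ∣ A p ∣ !)

open Arrangements

open import Data.Fin using (Fin; zero; suc; _<_)
open import Data.Fin.Properties using (<⇒≢)
open import Data.Fin.Subset using (Subset; _∩_; Empty; Nonempty; ∣_∣)
open import Data.Integer using (+_)
import Data.Integer as ℤ
import Data.Integer.Properties as ℤ
open import Data.Nat using (ℕ; _+_; _∸_; _≥_; _!)
open import Data.Nat.Combinatorics using (_C_)
import Data.Nat as ℕ
import Data.Nat.Properties as ℕ
open import Data.Nat.Properties using (_!≢0)
open import Data.Product using (Σ; _×_; _,_)
open import Data.Rational using (ℚ; _≤_; _/_; fromℚᵘ)
import Data.Rational as ℚ
import Data.Rational.Properties as ℚ
open import Data.Rational.Unnormalised using (*≡*; *≤*) renaming (_≤_ to _≤ᵘ_; _/_ to _/ᵘ_)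
import Data.Rational.Unnormalised.Properties as ℚᵘ
open import Relation.Binary.PropositionalEquality using (_≡_; _≢_; sym; trans; cong; cong₂; subst₂)

fromℚᵘ-mono-≤ : ∀ {p q} → p ≤ᵘ q → fromℚᵘ p ≤ fromℚᵘ q
fromℚᵘ-mono-≤ {p} {q} p≤q = ℚ.toℚᵘ-cancel-≤
  (ℚᵘ.≤-respʳ-≃ (ℚᵘ.≃-sym (ℚ.toℚᵘ-fromℚᵘ q)) (ℚᵘ.≤-respˡ-≃ (ℚᵘ.≃-sym (ℚ.toℚᵘ-fromℚᵘ p)) p≤q))

a*e≤c*b⇒a/b≤c/e : ∀ a b c e .{{_ : ℕ.NonZero b}} .{{_ : ℕ.NonZero e}} →
  a ℕ.* e ℕ.≤ c ℕ.* b → (+ a) / b ≤ (+ c) / e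
a*e≤c*b⇒a/b≤c/e a b@(ℕ.suc _) c e@(ℕ.suc _) ae≤cb = fromℚᵘ-mono-≤ {(+ a) /ᵘ b} {(+ c) /ᵘ e}
  (*≤* (subst₂ ℤ._≤_ (ℤ.pos-* a e) (ℤ.pos-* c b) (ℤ.+≤+ ae≤cb)))

+-/ : ∀ a b N .{{_ : ℕ.NonZero N}} → (+ a) / N ℚ.+ (+ b) / N ≡ (+ (a + b)) / N
+-/ a b N@(ℕ.suc _) = ℚ.toℚᵘ-injective (ℚᵘ.≃-trans (ℚ.toℚᵘ-homo-+ ((+ a) / N) ((+ b) / N))
  (ℚᵘ.≃-trans (ℚᵘ.+-cong (ℚ.toℚᵘ-fromℚᵘ ((+ a) /ᵘ N)) (ℚ.toℚᵘ-fromℚᵘ ((+ b) /ᵘ N)))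
  (ℚᵘ.≃-trans (*≡* (trans numerators (sym (cong₂ ℤ._*_ (ℤ.pos-+ a b) (ℤ.pos-* N N)))))
              (ℚᵘ.≃-sym (ℚ.toℚᵘ-fromℚᵘ ((+ (a + b)) /ᵘ N))))))
  where
  numerators : (+ a ℤ.* + N ℤ.+ + b ℤ.* + N) ℤ.* + N ≡ (+ a ℤ.+ + b) ℤ.* (+ N ℤ.* + N)
  numerators = trans (cong (ℤ._* + N) (sym (ℤ.*-distribʳ-+ (+ N) (+ a) (+ b)))) (ℤ.*-assoc (+ a ℤ.+ + b) (+ N) (+ N))

sumℚ-mono-≤ : ∀ {k} (f g : Fin k → ℚ) → (∀ i → f i ≤ g i) → sumℚ f ≤ sumℚ g
sumℚ-mono-≤ {ℕ.zero}  f g f≤g = ℚ.≤-refl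
sumℚ-mono-≤ {ℕ.suc k} f g f≤g = ℚ.+-mono-≤ (f≤g zero) (sumℚ-mono-≤ _ _ (λ i → f≤g (suc i)))

sumℚ-/ : ∀ {k} (s : Fin k → ℕ) N .{{_ : ℕ.NonZero N}} → sumℚ (λ i → (+ s i) / N) ≡ (+ sumℕ s) / N
sumℚ-/ {ℕ.zero}  s N = sym (ℚ.0/n≡0 N)
sumℚ-/ {ℕ.suc k} s N = trans (cong ((+ s zero) / N ℚ.+_) (sumℚ-/ (λ i → s (suc i)) N)) (+-/ (s zero) _ N)

invMultinomial≤arrangements/n! : ∀ {d n} (A : Partition (ℕ.suc d) n) → Disjoint A →
  invMultinomial (λ p → ∣ A p ∣) ≤ ((+ arrangements zeros A) / n !) {{n !≢0}}
invMultinomial≤arrangements/n! {n = n} A disj =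
  a*e≤c*b⇒a/b≤c/e (prodℕ (λ p → ∣ A p ∣ !)) (sumℕ (λ p → ∣ A p ∣) !) (arrangements zeros A) (n !)
    {{sumℕ (λ p → ∣ A p ∣) !≢0}} {{n !≢0}}
    (prodℕ-!*n!≤arrangements*sumℕ! A disj)

theorem7 : (n d m : ℕ) → n ≥ 1 → d ≥ 1 →
    (A : Fin m → Fin d → Subset n) →
    (∀ i (p q : Fin d) → p ≢ q → Empty (A i p ∩ A i q)) →
    (∀ (i j : Fin m) → i < j →
      Σ (Fin d) (λ p → Σ (Fin d) (λ q → p < q × Nonempty (A i p ∩ A j q)))) →
    sumℚ (λ i → invMultinomial (λ k → ∣ A i k ∣))
      ≤ (+ ((n + d ∸ 1) C (d ∸ 1))) / 1
theorem7 n (ℕ.suc d) m _ _ A disjoint skew = begin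
  sumℚ (λ i → invMultinomial (λ k → ∣ A i k ∣))
    ≤⟨ sumℚ-mono-≤ _ _ (λ i → invMultinomial≤arrangements/n! (A i) (disjoint i)) ⟩
  sumℚ (λ i → (+ arrangements zeros (A i)) / n !)
    ≡⟨ sumℚ-/ (λ i → arrangements zeros (A i)) (n !) ⟩
  (+ sumℕ (λ i → arrangements zeros (A i))) / n !
    ≤⟨ a*e≤c*b⇒a/b≤c/e (sumℕ (λ i → arrangements zeros (A i))) (n !) ((n + d) C d) 1 total≤ ⟩
  (+ ((n + d) C d)) / 1
    ≡⟨ cong (λ t → (+ ((t ∸ 1) C d)) / 1) (ℕ.+-suc n d) ⟨
  (+ ((n + ℕ.suc d ∸ 1) C d)) / 1 ∎
  where
  open ℚ.≤-Reasoning
  instance _ = n !≢0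
  total≤ : sumℕ (λ i → arrangements zeros (A i)) ℕ.* 1 ℕ.≤ ((n + d) C d) ℕ.* n !
  total≤ = ℕ.≤-trans (ℕ.≤-reflexive (ℕ.*-identityʳ _)) (sumℕ-arrangements≤[n+d]Cd*n! A λ i j i<j →
    let p , q , p<q , x∈ = skew i j i<j in p , q , <⇒≢ p<q , x∈)
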